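{- Let $p$ be an odd prime and $d$ an integer with $1\leq d\leq p-1$, and suppose that $\sum_{k=1}^{d}\frac{(-1)^{k-1}}{k}\not\equiv 0\pmod{p}$. Let $f_{m,n}(z)=\sum_{j=0}^{n}\binom{n}{j}z^{\binom{j}{m}}$. Then for every $n=j(p-1)p$ with $j\geq 1$ an integer and $p\nmid j$, the polynomial $f_{n-d,n}(z)$ is $p$-Eisenstein, and hence irreducible over $\mathbb{Q}$. If furthermore $p\equiv\pm 1\pmod 8$, then the same conclusion holds for all $n=j(p-1)p/2$ with $j\geq 1$ and $p\nmid j$.
   Context: Here $\binom{j}{m}=0$ for $0\le j<m$. The congruence of the rational number $\sum_{k=1}^d(-1)^{k-1}/k$ modulo $p$ is understood in $\mathbb{Z}_{(p)}$ (its denominator is coprime to $p$). A polynomial is $p$-Eisenstein if its leading coefficient is not divisible by $p$, all other coefficients are divisible by $p$, and the constant term is not divisible by $p^2$. -}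

module Defs where

open import Data.Nat using (ℕ; zero; suc; _+_; _*_; _^_; _<_; _⊔_; NonZero)
open import Data.Nat.Divisibility using (_∣_)
open import Data.Nat.Combinatorics using (_C_)
open import Data.List using (List; map; upTo; foldr)
open import Data.Nat.ListAction using (sum)
open import Data.Bool using (if_then_else_)
open import Data.Nat using (_≡ᵇ_)
open import Data.Product using (_×_)
open import Relation.Nullary using (¬_)
open import Data.Integer as ℤ using (ℤ; +_; -[1+_])
open import Data.Rational as ℚ using (ℚ; ↥_)

record Poly : Set where
  field
    deg   : ℕ
    coeff : ℕ → ℕ
open Poly public

IsEisenstein : ℕ → Poly → Set
IsEisenstein p f =
  ¬ (p ∣ coeff f (deg f))
  × (∀ i → i < deg f → p ∣ coeff f i)
  × ¬ ((p ^ 2) ∣ coeff f 0)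

-- f_{m,n}(z) = Σ_{j=0}^{n} C(n,j) z^{C(j,m)}   (C(j,m) = 0 for j < m)
-- Coefficient of z^e: sum of C(n,j) over j ≤ n with C(j,m) = e.
fCoeff : ℕ → ℕ → ℕ → ℕ
fCoeff m n e = sum (map (λ j → if (j C m) ≡ᵇ e then n C j else 0) (upTo (suc n)))

-- Degree: the largest exponent C(j,m), 0 ≤ j ≤ n, occurring (all the
-- coefficients C(n,j) are positive, so every such exponent really occurs).
fDeg : ℕ → ℕ → ℕ
fDeg m n = foldr _⊔_ 0 (map (λ j → j C m) (upTo (suc n)))

f : ℕ → ℕ → Poly
f m n = record { deg = fDeg m n ; coeff = fCoeff m n }

altHarmonic : ℕ → ℚ
altHarmonic zero = ℚ.0ℚ
altHarmonic (suc k) = altHarmonic k ℚ.+ (sign k ℚ./ suc k)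
  where
    sign : ℕ → ℤ
    sign k = if (k Data.Nat.% 2) ≡ᵇ 0 then ℤ.1ℤ else ℤ.-1ℤ

-- A rational r (whose denominator is prime to p) is ≡ 0 mod p in Z_(p)
-- iff p divides its numerator.
≡0modp : ℕ → ℚ → Set
≡0modp p r = p ∣ ℤ.∣ ↥ r ∣

{-# OPTIONS --safe #-}

-- The exponents C(j, n − d) of f = f_{n−d,n} vanish for j < n − d and increase strictly from
-- j = n − d on, so f has leading coefficient C(n, n) = 1, its other non-constant coefficients
-- are the C(n, j) with 1 ≤ n − j ≤ d < p, all divisible by p because p ∣ n, and its constant
-- term is c₀ = Σ_{j < n−d} C(n, j) = 2ⁿ − Σ_{i ≤ d} C(n, i).
-- Let n = N p with p ∤ N. From i C(n, i) = n C(n − 1, i − 1) and C(n − 1, i − 1) ≡ (−1)^{i−1}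
-- (mod p) we get Σ_{1 ≤ i ≤ d} C(n, i) ≡ n H_d (mod p²), and 2ⁿ ≡ 1 (mod p²) as soon as
-- 2ᴺ ≡ 1 (mod p). Hence c₀ ≡ −N p H_d (mod p²) is divisible by p, and by p² only if p ∣ H_d.
-- The condition 2ᴺ ≡ 1 (mod p) holds for N = j (p − 1) by Fermat, and for N = j (p − 1)/2 when
-- p ≡ ±1 (mod 8) by Gauss's lemma.
module Submission where

open import Defs
open import Data.Nat using (ℕ; _+_; _*_; _∸_; _≤_; _/_; _%_)
open import Data.Nat.Divisibility using (_∣_)
open import Data.Nat.Primality using (Prime)
open import Data.Product using (_×_)
open import Data.Sum using (_⊎_)
open import Relation.Nullary using (¬_)
open import Relation.Binary.PropositionalEquality using (_≡_; _≢_)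

open import Algebra.Bundles using (CommutativeSemigroup)
import Algebra.Properties.CommutativeSemigroup
open import Algebra.Structures using (IsCommutativeMonoid)
open import Data.Bool using (if_then_else_)
open import Data.Integer as ℤ using (ℤ; +_; 0ℤ; 1ℤ; -1ℤ)
import Data.Integer.Divisibility.Signed as ℤ∣
open ℤ∣ using (divides) renaming (_∣_ to _∣ℤ_)
import Data.Integer.Properties as ℤ
open import Data.Integer.Tactic.RingSolver using (solve-∀)
open import Data.List using (foldr; map; upTo; applyUpTo)
open import Data.List.Properties using (map-applyUpTo)
open import Data.Nat using (zero; suc; _<_; _^_; _!; _≡ᵇ_; _⊔_; z≤n; s≤s; s≤s⁻¹; NonZero; nonTrivial⇒n>1)
open import Data.Nat.Combinatorics using (_C_; k>n⇒nCk≡0; nCk≡nC[n∸k]; nCn≡1; nC1≡n; nCk+nC[k+1]≡[n+1]C[k+1])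
open import Data.Nat.Divisibility using (divides; ∣-refl; m∣m*n; n∣m*n; ∣m⇒∣m*n; ∣m∣n⇒∣m+n; _∣0; >⇒∤; ∣⇒≤)
open import Data.Nat.DivMod using (m≡m%n+[m/n]*n; m*n/n≡m)
open import Data.Nat.Primality using (euclidsLemma; prime⇒nonTrivial; ¬prime[0])
open import Data.Nat.Properties
import Data.Nat.Tactic.RingSolver as ℕ-Solver
open import Data.Product using (_,_; proj₁; proj₂; ∃-syntax)
open import Data.Rational as ℚ using (mkℚ)
import Data.Rational.Properties as ℚ
open import Data.Rational.Unnormalised as ℚᵘ using (ℚᵘ; mkℚᵘ)
import Data.Rational.Unnormalised.Properties as ℚᵘ
open import Data.Sum using (inj₁; inj₂)
open import Function using (_∘_)
open import Level using (0ℓ)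
open import Relation.Binary.Bundles using (Setoid)
open import Relation.Binary.PropositionalEquality
  using (refl; sym; trans; cong; cong₂; subst; subst₂; module ≡-Reasoning)
import Relation.Binary.Reasoning.Setoid as SetoidReasoning
open import Relation.Binary.Structures using (IsEquivalence)
open import Relation.Nullary using (contradiction; yes; no)
open import Relation.Nullary.Decidable using (dec-true; dec-false)

-- Finite sums, products and maxima

module BigOperator {A : Set} {_∙_ : A → A → A} {ε : A}
                   (isCommutativeMonoid : IsCommutativeMonoid _≡_ _∙_ ε) where

  open IsCommutativeMonoid isCommutativeMonoid
    using (assoc; comm; identityˡ; identityʳ; isCommutativeSemigroup)

  private
    commutativeSemigroup : CommutativeSemigroup 0ℓ 0ℓ
    commutativeSemigroup = record { isCommutativeSemigroup = isCommutativeSemigroup }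

  open Algebra.Properties.CommutativeSemigroup commutativeSemigroup using (interchange)

  big : ℕ → (ℕ → A) → A
  big zero    g = ε
  big (suc n) g = big n g ∙ g n

  pointwise : ∀ n {g h} → (∀ i → i < n → g i ≡ h i) → big n g ≡ big n h
  pointwise zero    g≡h = refl
  pointwise (suc n) g≡h = cong₂ _∙_ (pointwise n (λ i i<n → g≡h i (m<n⇒m<1+n i<n))) (g≡h n ≤-refl)

  closed : ∀ (P : A → Set) n {g} → P ε → (∀ {x y} → P x → P y → P (x ∙ y))
         → (∀ i → i < n → P (g i)) → P (big n g)
  closed P zero    Pε P∙ Pg = Pε
  closed P (suc n) Pε P∙ Pg = P∙ (closed P n Pε P∙ (λ i i<n → Pg i (m<n⇒m<1+n i<n))) (Pg n ≤-refl)

  front : ∀ n g → big (suc n) g ≡ g 0 ∙ big n (g ∘ suc)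
  front zero    g = trans (identityˡ (g 0)) (sym (identityʳ (g 0)))
  front (suc n) g = trans (cong (_∙ g (suc n)) (front n g)) (assoc (g 0) _ _)

  fromList : ∀ n g → foldr _∙_ ε (map g (upTo n)) ≡ big n g
  fromList n g = trans (cong (foldr _∙_ ε) (map-applyUpTo (λ i → i) g n)) (foldr-applyUpTo n g)
    where
    foldr-applyUpTo : ∀ n g → foldr _∙_ ε (applyUpTo g n) ≡ big n g
    foldr-applyUpTo zero    g = refl
    foldr-applyUpTo (suc n) g = trans (cong (g 0 ∙_) (foldr-applyUpTo n (g ∘ suc))) (sym (front n g))

  split : ∀ m n g → big (m + n) g ≡ big m g ∙ big n (λ i → g (m + i))
  split m zero    g = trans (cong (λ k → big k g) (+-identityʳ m)) (sym (identityʳ _))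
  split m (suc n) g = begin
    big (m + suc n) g                                ≡⟨ cong (λ k → big k g) (+-suc m n) ⟩
    big (m + n) g ∙ g (m + n)                        ≡⟨ cong (_∙ g (m + n)) (split m n g) ⟩
    (big m g ∙ big n (λ i → g (m + i))) ∙ g (m + n)  ≡⟨ assoc _ _ _ ⟩
    big m g ∙ big (suc n) (λ i → g (m + i))          ∎
    where open ≡-Reasoning

  reverse : ∀ n g → big n (λ i → g (n ∸ suc i)) ≡ big n g
  reverse zero    g = refl
  reverse (suc n) g = begin
    big (suc n) (λ i → g (n ∸ i))      ≡⟨ front n (λ i → g (n ∸ i)) ⟩
    g n ∙ big n (λ i → g (n ∸ suc i))  ≡⟨ cong (g n ∙_) (reverse n g) ⟩
    g n ∙ big n g                      ≡⟨ comm (g n) (big n g) ⟩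
    big (suc n) g                      ∎
    where open ≡-Reasoning

  distrib : ∀ n g h → big n (λ i → g i ∙ h i) ≡ big n g ∙ big n h
  distrib zero    g h = sym (identityˡ ε)
  distrib (suc n) g h = begin
    big n (λ i → g i ∙ h i) ∙ (g n ∙ h n)  ≡⟨ cong (_∙ (g n ∙ h n)) (distrib n g h) ⟩
    (big n g ∙ big n h) ∙ (g n ∙ h n)      ≡⟨ interchange _ _ _ _ ⟩
    (big n g ∙ g n) ∙ (big n h ∙ h n)      ∎
    where open ≡-Reasoning

module Sum     = BigOperator +-0-isCommutativeMonoid
module Product = BigOperator *-1-isCommutativeMonoid
module Maximum = BigOperator ⊔-0-isCommutativeMonoid

∑ ∏ ⨆ : ℕ → (ℕ → ℕ) → ℕ
∑ = Sum.big
∏ = Product.big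
⨆ = Maximum.big

∑-zero : ∀ n {g} → (∀ i → i < n → g i ≡ 0) → ∑ n g ≡ 0
∑-zero n = Sum.closed (_≡ 0) n refl (cong₂ _+_)

∑-∣ : ∀ {p} n {g} → (∀ i → i < n → p ∣ g i) → p ∣ ∑ n g
∑-∣ {p} n = Sum.closed (p ∣_) n (p ∣0) ∣m∣n⇒∣m+n

⨆-monotone : ∀ n {g} → (∀ {i j} → i ≤ j → g i ≤ g j) → ⨆ (suc n) g ≡ g n
⨆-monotone zero          _      = refl
⨆-monotone (suc n) {g} g-mono =
  trans (cong (_⊔ g (suc n)) (⨆-monotone n g-mono)) (m≤n⇒m⊔n≡n (g-mono (n≤1+n n)))

-- Binomial coefficients and primes

C-absorb : ∀ n k → suc k * (suc n C suc k) ≡ suc n * (n C k)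
C-absorb zero    zero    = refl
C-absorb zero    (suc k) = *-zeroʳ (suc (suc k))
C-absorb (suc n) zero    = trans (+-identityʳ _) (trans (nC1≡n (suc (suc n))) (sym (*-identityʳ _)))
C-absorb (suc n) (suc k) = begin
  suc (suc k) * (suc (suc n) C suc (suc k))
    ≡⟨ cong (suc (suc k) *_) (nCk+nC[k+1]≡[n+1]C[k+1] (suc n) (suc k)) ⟨
  suc (suc k) * (suc n C suc k + suc n C suc (suc k))
    ≡⟨ distribute k (suc n C suc k) (suc n C suc (suc k)) ⟩
  suc k * (suc n C suc k) + suc (suc k) * (suc n C suc (suc k)) + suc n C suc k
    ≡⟨ cong₂ (λ u v → u + v + suc n C suc k) (C-absorb n k) (C-absorb n (suc k)) ⟩
  suc n * (n C k) + suc n * (n C suc k) + suc n C suc k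
    ≡⟨ cong (_+ suc n C suc k) (*-distribˡ-+ (suc n) (n C k) (n C suc k)) ⟨
  suc n * (n C k + n C suc k) + suc n C suc k
    ≡⟨ cong (λ c → suc n * c + suc n C suc k) (nCk+nC[k+1]≡[n+1]C[k+1] n k) ⟩
  suc n * (suc n C suc k) + suc n C suc k
    ≡⟨ +-comm (suc n * (suc n C suc k)) (suc n C suc k) ⟩
  suc (suc n) * (suc n C suc k)
    ∎
  where
  open ≡-Reasoning
  distribute : ∀ k a b → suc (suc k) * (a + b) ≡ suc k * a + suc (suc k) * b + a
  distribute = ℕ-Solver.solve-∀

C-pos : ∀ {n k} → k ≤ n → 0 < n C k
C-pos {n}     {zero}  _         = s≤s z≤n
C-pos {suc n} {suc k} (s≤s k≤n) =
  subst (0 <_) (nCk+nC[k+1]≡[n+1]C[k+1] n k) (≤-trans (C-pos k≤n) (m≤m+n (n C k) (n C suc k)))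

C-≤-suc : ∀ n m → n C m ≤ suc n C m
C-≤-suc n zero    = ≤-refl
C-≤-suc n (suc m) = subst (n C suc m ≤_) (nCk+nC[k+1]≡[n+1]C[k+1] n m) (m≤n+m (n C suc m) (n C m))

C-monoˡ-≤ : ∀ m {i n} → i ≤ n → i C m ≤ n C m
C-monoˡ-≤ m {i} i≤n = subst (λ n → i C m ≤ n C m) (m∸n+n≡m i≤n) (shift (_ ∸ i))
  where
  shift : ∀ k → i C m ≤ (k + i) C m
  shift zero    = ≤-refl
  shift (suc k) = ≤-trans (shift k) (C-≤-suc (k + i) m)

C-monoˡ-< : ∀ {m j n} → 0 < m → m ≤ n → j < n → j C m < n C m
C-monoˡ-< {suc m} {j} {n} _ m<n j<n with m ≤? j
... | yes m≤j = begin-strict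
  j C suc m              <⟨ m<n+m (j C suc m) (C-pos m≤j) ⟩
  j C m + j C suc m      ≡⟨ nCk+nC[k+1]≡[n+1]C[k+1] j m ⟩
  suc j C suc m          ≤⟨ C-monoˡ-≤ (suc m) j<n ⟩
  n C suc m              ∎
  where open ≤-Reasoning
... | no  m≰j = subst (_< n C suc m) (sym (k>n⇒nCk≡0 (m<n⇒m<1+n (≰⇒> m≰j)))) (C-pos m<n)

∑-binomial : ∀ n → ∑ (suc n) (n C_) ≡ 2 ^ n
∑-binomial zero    = refl
∑-binomial (suc n) = begin
  ∑ (suc (suc n)) (suc n C_)               ≡⟨ Sum.front (suc n) (suc n C_) ⟩
  1 + ∑ (suc n) (λ j → suc n C suc j)      ≡⟨ cong suc (Sum.pointwise (suc n) pascal) ⟨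
  1 + ∑ (suc n) (λ j → n C j + n C suc j)  ≡⟨ cong suc (Sum.distrib (suc n) (n C_) (λ j → n C suc j)) ⟩
  1 + (X + ∑ (suc n) (λ j → n C suc j))    ≡⟨ +-assoc-comm 1 X _ ⟩
  X + (1 + ∑ (suc n) (λ j → n C suc j))    ≡⟨ cong (_+_ X) (Sum.front (suc n) (n C_)) ⟨
  X + (X + n C suc n)                      ≡⟨ cong (λ c → X + (X + c)) (k>n⇒nCk≡0 (n<1+n n)) ⟩
  X + (X + 0)                              ≡⟨ cong (λ s → s + (s + 0)) (∑-binomial n) ⟩
  2 ^ suc n                                ∎
  where
  open ≡-Reasoning
  X = ∑ (suc n) (n C_)
  pascal : ∀ j → j < suc n → n C j + n C suc j ≡ suc n C suc j
  pascal j _ = nCk+nC[k+1]≡[n+1]C[k+1] n j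
  +-assoc-comm : ∀ a b c → a + (b + c) ≡ b + (a + c)
  +-assoc-comm = ℕ-Solver.solve-∀

∑-binomial-inner : ∀ n → 2 + ∑ n (λ j → suc n C suc j) ≡ 2 ^ suc n
∑-binomial-inner n = begin
  2 + X                       ≡⟨ cong suc (+-comm 1 X) ⟩
  (1 + X) + 1                 ≡⟨ cong₂ _+_ (Sum.front n (suc n C_)) (nCn≡1 (suc n)) ⟨
  ∑ (suc (suc n)) (suc n C_)  ≡⟨ ∑-binomial (suc n) ⟩
  2 ^ suc n                   ∎
  where
  open ≡-Reasoning
  X = ∑ n (λ j → suc n C suc j)

∑-C-complement : ∀ m d {n} → m + d ≡ n → ∑ m (n C_) + ∑ (suc d) (n C_) ≡ 2 ^ n
∑-C-complement m d refl = begin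
  ∑ m (n C_) + ∑ (suc d) (n C_)               ≡⟨ cong (_+_ (∑ m (n C_))) (Sum.reverse (suc d) (n C_)) ⟨
  ∑ m (n C_) + ∑ (suc d) (λ i → n C (d ∸ i))  ≡⟨ cong (_+_ (∑ m (n C_))) (Sum.pointwise (suc d) symmetry) ⟨
  ∑ m (n C_) + ∑ (suc d) (λ i → n C (m + i))  ≡⟨ Sum.split m (suc d) (n C_) ⟨
  ∑ (m + suc d) (n C_)                        ≡⟨ cong (λ k → ∑ k (n C_)) (+-suc m d) ⟩
  ∑ (suc n) (n C_)                            ≡⟨ ∑-binomial n ⟩
  2 ^ n                                       ∎
  where
  open ≡-Reasoning
  n = m + d
  symmetry : ∀ i → i < suc d → n C (m + i) ≡ n C (d ∸ i)
  symmetry i i<1+d = trans (nCk≡nC[n∸k] (+-monoʳ-≤ m (s≤s⁻¹ i<1+d))) (cong (n C_) ([m+n]∸[m+o]≡n∸o m d i))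

prime>1 : ∀ {p} → Prime p → 1 < p
prime>1 {p} p-prime = nonTrivial⇒n>1 p {{prime⇒nonTrivial p-prime}}

prime∣m*n∧∤m⇒∣n : ∀ {p m n} → Prime p → ¬ p ∣ m → p ∣ m * n → p ∣ n
prime∣m*n∧∤m⇒∣n {m = m} {n} p-prime p∤m p∣mn with euclidsLemma m n p-prime p∣mn
... | inj₁ p∣m = contradiction p∣m p∤m
... | inj₂ p∣n = p∣n

prime∤m*n : ∀ {p m n} → Prime p → ¬ p ∣ m → 0 < n → n < p → ¬ p ∣ m * n
prime∤m*n {p} {m} {suc n} p-prime p∤m _ n<p p∣mn =
  p∤m (prime∣m*n∧∤m⇒∣n p-prime (>⇒∤ n<p) (subst (p ∣_) (*-comm m (suc n)) p∣mn))

prime∤! : ∀ {p} k → Prime p → k < p → ¬ p ∣ k !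
prime∤! zero    p-prime _   = >⇒∤ (prime>1 p-prime)
prime∤! (suc k) p-prime k<p p∣k! =
  prime∤! k p-prime (<⇒≤ k<p) (prime∣m*n∧∤m⇒∣n p-prime (>⇒∤ k<p) p∣k!)

prime∣C : ∀ {p n k} → Prime p → p ∣ n → 0 < k → k < p → p ∣ n C k
prime∣C {p} {zero}  {suc k} _       _   _ _   = p ∣0
prime∣C {p} {suc n} {suc k} p-prime p∣n _ k<p =
  prime∣m*n∧∤m⇒∣n p-prime (>⇒∤ k<p) (subst (p ∣_) (sym (C-absorb n k)) (∣m⇒∣m*n (n C k) p∣n))

-- Congruences of integers

infix 4 _≡_mod_

-- A record, not a definition by `+ m ∣ a - b`, so that a, b and m can be inferred.
record _≡_mod_ (a b : ℤ) (m : ℕ) : Set where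
  constructor mod-divides
  field divides-difference : + m ∣ℤ a ℤ.- b

mod-by : ∀ {a b c m} → a ℤ.- b ≡ c → + m ∣ℤ c → a ≡ b mod m
mod-by a-b≡c m∣c = mod-divides (subst (_ ∣ℤ_) (sym a-b≡c) m∣c)

≡⇒≡-mod : ∀ {a b m} → a ≡ b → a ≡ b mod m
≡⇒≡-mod {a} {m = m} refl = mod-divides (divides 0ℤ (trans (ℤ.+-inverseʳ a) (sym (ℤ.*-zeroˡ (+ m)))))

mod-sym : ∀ {a b m} → a ≡ b mod m → b ≡ a mod m
mod-sym {a} {b} (mod-divides m∣a-b) = mod-by (swap a b) (ℤ∣.∣m⇒∣-m m∣a-b)
  where
  swap : ∀ a b → b ℤ.- a ≡ ℤ.- (a ℤ.- b)
  swap = solve-∀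

mod-trans : ∀ {a b c m} → a ≡ b mod m → b ≡ c mod m → a ≡ c mod m
mod-trans {a} {b} {c} (mod-divides m∣a-b) (mod-divides m∣b-c) =
  mod-by (sym (ℤ.+-minus-telescope a b c)) (ℤ∣.∣m∣n⇒∣m+n m∣a-b m∣b-c)

mod-isEquivalence : ∀ m → IsEquivalence (λ a b → a ≡ b mod m)
mod-isEquivalence m = record { refl = ≡⇒≡-mod refl ; sym = mod-sym ; trans = mod-trans }

mod-setoid : ℕ → Setoid 0ℓ 0ℓ
mod-setoid m = record { isEquivalence = mod-isEquivalence m }

module ≡-mod-Reasoning (m : ℕ) = SetoidReasoning (mod-setoid m)

+-cong-mod : ∀ {a b c d m} → a ≡ b mod m → c ≡ d mod m → a ℤ.+ c ≡ b ℤ.+ d mod m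
+-cong-mod {a} {b} {c} {d} (mod-divides m∣a-b) (mod-divides m∣c-d) =
  mod-by (regroup a b c d) (ℤ∣.∣m∣n⇒∣m+n m∣a-b m∣c-d)
  where
  regroup : ∀ a b c d → (a ℤ.+ c) ℤ.- (b ℤ.+ d) ≡ (a ℤ.- b) ℤ.+ (c ℤ.- d)
  regroup = solve-∀

*-cong-mod : ∀ {a b c d m} → a ≡ b mod m → c ≡ d mod m → a ℤ.* c ≡ b ℤ.* d mod m
*-cong-mod {a} {b} {c} {d} (mod-divides m∣a-b) (mod-divides m∣c-d) =
  mod-by (regroup a b c d) (ℤ∣.∣m∣n⇒∣m+n (ℤ∣.∣m⇒∣m*n c m∣a-b) (ℤ∣.∣n⇒∣m*n b m∣c-d))
  where
  regroup : ∀ a b c d → a ℤ.* c ℤ.- b ℤ.* d ≡ (a ℤ.- b) ℤ.* c ℤ.+ b ℤ.* (c ℤ.- d)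
  regroup = solve-∀

*-congˡ-mod : ∀ {a b m} c → a ≡ b mod m → c ℤ.* a ≡ c ℤ.* b mod m
*-congˡ-mod c = *-cong-mod (≡⇒≡-mod {c} refl)

-‿cong-mod : ∀ {a b m} → a ≡ b mod m → ℤ.- a ≡ ℤ.- b mod m
-‿cong-mod {a} {b} (mod-divides m∣a-b) = mod-by (regroup a b) (ℤ∣.∣m⇒∣-m m∣a-b)
  where
  regroup : ∀ a b → ℤ.- a ℤ.- ℤ.- b ≡ ℤ.- (a ℤ.- b)
  regroup = solve-∀

^-cong-mod : ∀ {a b m} k → a ≡ b mod m → a ℤ.^ k ≡ b ℤ.^ k mod m
^-cong-mod zero    a≡b = ≡⇒≡-mod refl
^-cong-mod (suc k) a≡b = *-cong-mod a≡b (^-cong-mod k a≡b)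

mod-weaken : ∀ {a b m} k → a ≡ b mod (m * k) → a ≡ b mod m
mod-weaken k (mod-divides mk∣a-b) = mod-divides (ℤ∣.∣-trans (ℤ∣.∣ᵤ⇒∣ (m∣m*n k)) mk∣a-b)

mod-divide : ∀ {m x c k} .{{_ : NonZero m}} → + (c * m) ℤ.* x ≡ 0ℤ mod (k * m) → + c ℤ.* x ≡ 0ℤ mod k
mod-divide {m} {x} {c} {k} (mod-divides km∣cmx) =
  mod-divides (ℤ∣.*-cancelʳ-∣ (+ m) (subst₂ _∣ℤ_ (ℤ.pos-* k m) factor km∣cmx))
  where
  regroup : ∀ c m x → c ℤ.* m ℤ.* x ℤ.- 0ℤ ≡ (c ℤ.* x ℤ.- 0ℤ) ℤ.* m
  regroup = solve-∀
  factor : + (c * m) ℤ.* x ℤ.- 0ℤ ≡ (+ c ℤ.* x ℤ.- 0ℤ) ℤ.* + m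
  factor = trans (cong (λ z → z ℤ.* x ℤ.- 0ℤ) (ℤ.pos-* c m)) (regroup (+ c) (+ m) x)

scale-mod : ∀ {m x y c k} → m ∣ c → x ≡ y mod k → + c ℤ.* x ≡ + c ℤ.* y mod (m * k)
scale-mod {m} {x} {y} {c} {k} (divides q c≡qm) (mod-divides (divides r x-y≡rk)) =
  mod-divides (divides (+ q ℤ.* r) (begin
    + c ℤ.* x ℤ.- + c ℤ.* y      ≡⟨ factor (+ c) x y ⟩
    + c ℤ.* (x ℤ.- y)            ≡⟨ cong₂ ℤ._*_ (trans (cong +_ c≡qm) (ℤ.pos-* q m)) x-y≡rk ⟩
    + q ℤ.* + m ℤ.* (r ℤ.* + k)  ≡⟨ regroup (+ q) (+ m) r (+ k) ⟩
    + q ℤ.* r ℤ.* (+ m ℤ.* + k)  ≡⟨ cong (+ q ℤ.* r ℤ.*_) (ℤ.pos-* m k) ⟨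
    + q ℤ.* r ℤ.* + (m * k)      ∎))
  where
  open ≡-Reasoning
  factor : ∀ c x y → c ℤ.* x ℤ.- c ℤ.* y ≡ c ℤ.* (x ℤ.- y)
  factor = solve-∀
  regroup : ∀ q m r k → q ℤ.* m ℤ.* (r ℤ.* k) ≡ q ℤ.* r ℤ.* (m ℤ.* k)
  regroup = solve-∀

≡0-mod⇒∣ : ∀ {x m} → x ≡ 0ℤ mod m → m ∣ ℤ.∣ x ∣
≡0-mod⇒∣ {x} (mod-divides m∣x-0) = subst (λ y → _ ∣ ℤ.∣ y ∣) (ℤ.+-identityʳ x) (ℤ∣.∣⇒∣ᵤ m∣x-0)

∣⇒≡0-mod : ∀ {m} x → m ∣ ℤ.∣ x ∣ → x ≡ 0ℤ mod m
∣⇒≡0-mod x m∣x = mod-by (ℤ.+-identityʳ x) (ℤ∣.∣ᵤ⇒∣ m∣x)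

cancel-mod : ∀ {p c x} → Prime p → ¬ p ∣ c → + c ℤ.* x ≡ 0ℤ mod p → p ∣ ℤ.∣ x ∣
cancel-mod {p} {c} {x} p-prime p∤c cx≡0 =
  prime∣m*n∧∤m⇒∣n p-prime p∤c (subst (p ∣_) (ℤ.abs-* (+ c) x) (≡0-mod⇒∣ cx≡0))

complement-mod : ∀ {x y m} → x + y ≡ m → + x ≡ ℤ.- + y mod m
complement-mod {x} {y} refl =
  mod-by (trans (cancel (+ x) (+ y)) (sym (ℤ.pos-+ x y))) (divides 1ℤ (sym (ℤ.*-identityˡ _)))
  where
  cancel : ∀ a b → a ℤ.- ℤ.- b ≡ a ℤ.+ b
  cancel = solve-∀

pos-m+n≡o⇒n≡o-m : ∀ m n {o} → m + n ≡ o → + n ≡ + o ℤ.- + m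
pos-m+n≡o⇒n≡o-m m n refl = begin
  + n                  ≡⟨ cancel (+ m) (+ n) ⟩
  + m ℤ.+ + n ℤ.- + m  ≡⟨ cong (ℤ._- + m) (ℤ.pos-+ m n) ⟨
  + (m + n) ℤ.- + m    ∎
  where
  open ≡-Reasoning
  cancel : ∀ a b → b ≡ a ℤ.+ b ℤ.- a
  cancel = solve-∀

pos-^ : ∀ a k → + (a ^ k) ≡ (+ a) ℤ.^ k
pos-^ a zero    = refl
pos-^ a (suc k) = trans (ℤ.pos-* a (a ^ k)) (cong (+ a ℤ.*_) (pos-^ a k))

-- Powers of 2 modulo p and p²

-- Write x = 1 + u with m ∣ u: each further factor x adds u, up to a multiple of u², which m² divides.
^-≡-1+k[x-1] : ∀ {x m} k → x ≡ 1ℤ mod m → x ℤ.^ k ≡ 1ℤ ℤ.+ + k ℤ.* (x ℤ.- 1ℤ) mod (m * m)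
^-≡-1+k[x-1] zero    _ = ≡⇒≡-mod refl
^-≡-1+k[x-1] {x} {m} (suc k) x≡1@(mod-divides (divides r x-1≡rm)) =
  mod-trans (*-congˡ-mod x (^-≡-1+k[x-1] k x≡1)) (mod-by excess (divides (+ k ℤ.* r ℤ.* r) refl))
  where
  open ≡-Reasoning
  expand : ∀ x k → x ℤ.* (1ℤ ℤ.+ k ℤ.* (x ℤ.- 1ℤ)) ℤ.- (1ℤ ℤ.+ (1ℤ ℤ.+ k) ℤ.* (x ℤ.- 1ℤ))
                 ≡ k ℤ.* (x ℤ.- 1ℤ) ℤ.* (x ℤ.- 1ℤ)
  expand = solve-∀
  regroup : ∀ k r m → k ℤ.* (r ℤ.* m) ℤ.* (r ℤ.* m) ≡ k ℤ.* r ℤ.* r ℤ.* (m ℤ.* m)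
  regroup = solve-∀
  excess : x ℤ.* (1ℤ ℤ.+ + k ℤ.* (x ℤ.- 1ℤ)) ℤ.- (1ℤ ℤ.+ + suc k ℤ.* (x ℤ.- 1ℤ))
         ≡ + k ℤ.* r ℤ.* r ℤ.* + (m * m)
  excess = begin
    _                                    ≡⟨ expand x (+ k) ⟩
    + k ℤ.* (x ℤ.- 1ℤ) ℤ.* (x ℤ.- 1ℤ)    ≡⟨ cong₂ (λ u v → + k ℤ.* u ℤ.* v) x-1≡rm x-1≡rm ⟩
    + k ℤ.* (r ℤ.* + m) ℤ.* (r ℤ.* + m)  ≡⟨ regroup (+ k) r (+ m) ⟩
    + k ℤ.* r ℤ.* r ℤ.* (+ m ℤ.* + m)    ≡⟨ cong (+ k ℤ.* r ℤ.* r ℤ.*_) (ℤ.pos-* m m) ⟨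
    + k ℤ.* r ℤ.* r ℤ.* + (m * m)        ∎

^-≡1-mod-square : ∀ {x m} → x ≡ 1ℤ mod m → x ℤ.^ m ≡ 1ℤ mod (m * m)
^-≡1-mod-square {x} {m} x≡1@(mod-divides (divides r x-1≡rm)) =
  mod-trans (^-≡-1+k[x-1] m x≡1) (mod-by excess (divides r refl))
  where
  open ≡-Reasoning
  cancel : ∀ m u → 1ℤ ℤ.+ m ℤ.* u ℤ.- 1ℤ ≡ m ℤ.* u
  cancel = solve-∀
  regroup : ∀ m r → m ℤ.* (r ℤ.* m) ≡ r ℤ.* (m ℤ.* m)
  regroup = solve-∀
  excess : 1ℤ ℤ.+ + m ℤ.* (x ℤ.- 1ℤ) ℤ.- 1ℤ ≡ r ℤ.* + (m * m)
  excess = begin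
    1ℤ ℤ.+ + m ℤ.* (x ℤ.- 1ℤ) ℤ.- 1ℤ  ≡⟨ cancel (+ m) (x ℤ.- 1ℤ) ⟩
    + m ℤ.* (x ℤ.- 1ℤ)                ≡⟨ cong (+ m ℤ.*_) x-1≡rm ⟩
    + m ℤ.* (r ℤ.* + m)               ≡⟨ regroup (+ m) r ⟩
    r ℤ.* (+ m ℤ.* + m)               ≡⟨ cong (r ℤ.*_) (ℤ.pos-* m m) ⟨
    r ℤ.* + (m * m)                   ∎

^-≡1-mod-multiple : ∀ {x m} j k → x ℤ.^ k ≡ 1ℤ mod m → x ℤ.^ (j * k) ≡ 1ℤ mod m
^-≡1-mod-multiple {x} {m} j k xᵏ≡1 = subst (λ e → x ℤ.^ e ≡ 1ℤ mod m) (*-comm k j)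
  (subst₂ (λ u v → u ≡ v mod m) (ℤ.^-*-assoc x k j) (ℤ.^-zeroˡ j) (^-cong-mod j xᵏ≡1))

fermat-2 : ∀ {p} → Prime p → p ≢ 2 → (+ 2) ℤ.^ (p ∸ 1) ≡ 1ℤ mod p
fermat-2 {p@(suc q)} p-prime p≢2 = mod-divides (ℤ∣.∣ᵤ⇒∣ (cancel-mod p-prime p∤2 (begin
  + 2 ℤ.* ((+ 2) ℤ.^ q ℤ.- 1ℤ)  ≡⟨ distribute (+ 2) ((+ 2) ℤ.^ q) ⟩
  (+ 2) ℤ.^ p ℤ.- + 2           ≡⟨ cong (ℤ._- + 2) (pos-^ 2 p) ⟨
  + (2 ^ p) ℤ.- + 2             ≡⟨ pos-m+n≡o⇒n≡o-m 2 X (∑-binomial-inner q) ⟨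
  + X                           ≈⟨ ∣⇒≡0-mod (+ X) p∣X ⟩
  0ℤ                            ∎)))
  where
  open ≡-mod-Reasoning p
  X = ∑ q (λ j → p C suc j)
  p∣X : p ∣ X
  p∣X = ∑-∣ q (λ j j<q → prime∣C p-prime ∣-refl (s≤s z≤n) (s≤s j<q))
  p∤2 : ¬ p ∣ 2
  p∤2 p∣2 = p≢2 (≤-antisym (∣⇒≤ p∣2) (prime>1 p-prime))
  distribute : ∀ a t → a ℤ.* (t ℤ.- 1ℤ) ≡ a ℤ.* t ℤ.- a
  distribute = solve-∀

-- (−1)ᵏ, written as in the definition of altHarmonic so that the two agree definitionally.
altSign : ℕ → ℤ
altSign k = if k % 2 ≡ᵇ 0 then 1ℤ else -1ℤ

altSign-suc : ∀ k → altSign (suc k) ≡ ℤ.- altSign k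
altSign-suc zero          = refl
altSign-suc (suc zero)    = refl
altSign-suc (suc (suc k)) = altSign-suc k

altSign-double : ∀ t → altSign (t + t) ≡ 1ℤ
altSign-double zero    = refl
altSign-double (suc t) = trans (cong (λ n → altSign (suc n)) (+-suc t t)) (altSign-double t)

∏-≡-altSign : ∀ n {g h m} → (∀ i → i < n → + g i ≡ ℤ.- + h i mod m)
  → + ∏ n g ≡ altSign n ℤ.* + ∏ n h mod m
∏-≡-altSign zero    _ = ≡⇒≡-mod refl
∏-≡-altSign (suc n) {g} {h} {m} g≡-h = begin
  + (∏ n g * g n)                        ≡⟨ ℤ.pos-* (∏ n g) (g n) ⟩
  + ∏ n g ℤ.* + g n                      ≈⟨ *-cong-mod (∏-≡-altSign n g≡-h′) (g≡-h n ≤-refl) ⟩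
  altSign n ℤ.* + ∏ n h ℤ.* ℤ.- + h n    ≡⟨ regroup (altSign n) (+ ∏ n h) (+ h n) ⟩
  ℤ.- altSign n ℤ.* (+ ∏ n h ℤ.* + h n)  ≡⟨ cong₂ ℤ._*_ (altSign-suc n) (ℤ.pos-* (∏ n h) (h n)) ⟨
  altSign (suc n) ℤ.* + (∏ n h * h n)    ∎
  where
  open ≡-mod-Reasoning m
  g≡-h′ : ∀ i → i < n → + g i ≡ ℤ.- + h i mod m
  g≡-h′ i i<n = g≡-h i (m<n⇒m<1+n i<n)
  regroup : ∀ s P x → s ℤ.* P ℤ.* ℤ.- x ≡ ℤ.- s ℤ.* (P ℤ.* x)
  regroup = solve-∀

evens odds : ℕ → ℕ
evens a = ∏ a (λ i → 2 * suc i)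
odds  b = ∏ b (λ i → suc (2 * i))

evens≡2^*! : ∀ a → evens a ≡ 2 ^ a * a !
evens≡2^*! zero    = refl
evens≡2^*! (suc a) = trans (cong (_* (2 * suc a)) (evens≡2^*! a)) (regroup (2 ^ a) (a !) a)
  where
  regroup : ∀ t f a → t * f * (2 * suc a) ≡ 2 * t * (suc a * f)
  regroup = ℕ-Solver.solve-∀

!-parity-split : ∀ a → (a + a) ! ≡ evens a * odds a × suc (a + a) ! ≡ evens a * odds (suc a)
!-parity-split zero    = refl , refl
!-parity-split (suc a) = even , odd
  where
  even : (suc a + suc a) ! ≡ evens (suc a) * odds (suc a)
  even = begin
    (suc a + suc a) !
      ≡⟨ cong (λ n → suc n !) (+-suc a a) ⟩
    suc (suc (a + a)) * (suc (a + a) * (a + a) !)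
      ≡⟨ cong (λ z → suc (suc (a + a)) * (suc (a + a) * z)) (proj₁ (!-parity-split a)) ⟩
    suc (suc (a + a)) * (suc (a + a) * (evens a * odds a))
      ≡⟨ regroup a (evens a) (odds a) ⟩
    evens a * (2 * suc a) * (odds a * suc (2 * a))
      ∎
    where
    open ≡-Reasoning
    regroup : ∀ a E O → suc (suc (a + a)) * (suc (a + a) * (E * O)) ≡ E * (2 * suc a) * (O * suc (2 * a))
    regroup = ℕ-Solver.solve-∀
  odd : suc (suc a + suc a) ! ≡ evens (suc a) * odds (suc (suc a))
  odd = trans (cong (suc (suc a + suc a) *_) even) (regroup a (evens (suc a)) (odds (suc a)))
    where
    regroup : ∀ a E O → suc (suc a + suc a) * (E * O) ≡ E * (O * suc (2 * suc a))
    regroup = ℕ-Solver.solve-∀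

!≡evens*odds : ∀ a b → b ≡ a ⊎ b ≡ suc a → (a + b) ! ≡ evens a * odds b
!≡evens*odds a _ (inj₁ refl) = proj₁ (!-parity-split a)
!≡evens*odds a _ (inj₂ refl) = trans (cong _! (+-suc a a)) (proj₂ (!-parity-split a))

-- Gauss's lemma for 2: 2ʰ h! = 2 · 4 ⋯ 2h, and modulo 2h + 1 the b largest of these factors are
-- −1, −3, …, −(2b − 1), while the a smallest are the even numbers up to h; together with the
-- odd numbers 1, 3, …, 2b − 1 these make up h!.
2^h*h!≡±h! : ∀ a b → b ≡ a ⊎ b ≡ suc a →
  + (2 ^ (a + b) * (a + b) !) ≡ altSign b ℤ.* + ((a + b) !) mod suc (2 * (a + b))
2^h*h!≡±h! a b b≡⌈h/2⌉ = begin
  + (2 ^ h * h !)                         ≡⟨ cong +_ (evens≡2^*! h) ⟨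
  + evens h                               ≡⟨ cong +_ (Product.split a b (λ i → 2 * suc i)) ⟩
  + (evens a * U)                         ≡⟨ ℤ.pos-* (evens a) U ⟩
  + evens a ℤ.* + U                       ≈⟨ *-congˡ-mod (+ evens a) upper ⟩
  + evens a ℤ.* (altSign b ℤ.* + odds b)  ≡⟨ regroup (+ evens a) (altSign b) (+ odds b) ⟩
  altSign b ℤ.* (+ evens a ℤ.* + odds b)  ≡⟨ cong (altSign b ℤ.*_) h!≡EO ⟨
  altSign b ℤ.* + (h !)                   ∎
  where
  open ≡-mod-Reasoning (suc (2 * (a + b)))
  h = a + b
  h!≡EO : + (h !) ≡ + evens a ℤ.* + odds b
  h!≡EO = trans (cong +_ (!≡evens*odds a b b≡⌈h/2⌉)) (ℤ.pos-* (evens a) (odds b))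
  U = ∏ b (λ i → 2 * suc (a + i))
  sums : ∀ i → i < b → 2 * suc (a + (b ∸ suc i)) + suc (2 * i) ≡ suc (2 * h)
  sums i i<b = trans (arith a (b ∸ suc i) i) (cong (λ c → suc (2 * (a + c))) (m∸n+n≡m i<b))
    where
    arith : ∀ a k i → 2 * suc (a + k) + suc (2 * i) ≡ suc (2 * (a + (k + suc i)))
    arith = ℕ-Solver.solve-∀
  upper : + U ≡ altSign b ℤ.* + odds b mod suc (2 * h)
  upper = subst (λ z → + z ≡ altSign b ℤ.* + odds b mod suc (2 * h)) (Product.reverse b (λ i → 2 * suc (a + i)))
    (∏-≡-altSign b (λ i i<b → complement-mod (sums i i<b)))
  regroup : ∀ e s o → e ℤ.* (s ℤ.* o) ≡ s ℤ.* (e ℤ.* o)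
  regroup = solve-∀

2^h≡1 : ∀ {p} a b → Prime p → p ≡ suc (2 * (a + b)) → b ≡ a ⊎ b ≡ suc a → altSign b ≡ 1ℤ
  → (+ 2) ℤ.^ (a + b) ≡ 1ℤ mod p
2^h≡1 a b p-prime refl b≡⌈h/2⌉ sign≡1 =
  mod-divides (ℤ∣.∣ᵤ⇒∣ (cancel-mod p-prime (prime∤! h p-prime h<p) (begin
  + (h !) ℤ.* ((+ 2) ℤ.^ h ℤ.- 1ℤ)     ≡⟨ distribute (+ (h !)) ((+ 2) ℤ.^ h) ⟩
  (+ 2) ℤ.^ h ℤ.* + (h !) ℤ.- + (h !)  ≡⟨ cong (ℤ._- + (h !)) 2ʰh!≡ ⟩
  + (2 ^ h * h !) ℤ.- + (h !)          ≈⟨ +-cong-mod (2^h*h!≡±h! a b b≡⌈h/2⌉) (≡⇒≡-mod refl) ⟩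
  altSign b ℤ.* + (h !) ℤ.- + (h !)    ≡⟨ cong (λ s → s ℤ.* + (h !) ℤ.- + (h !)) sign≡1 ⟩
  1ℤ ℤ.* + (h !) ℤ.- + (h !)           ≡⟨ cancel (+ (h !)) ⟩
  0ℤ                                   ∎)))
  where
  open ≡-mod-Reasoning (suc (2 * (a + b)))
  h = a + b
  h<p : h < suc (2 * h)
  h<p = s≤s (m≤m+n h (h + 0))
  2ʰh!≡ : (+ 2) ℤ.^ h ℤ.* + (h !) ≡ + (2 ^ h * h !)
  2ʰh!≡ = trans (cong (ℤ._* + (h !)) (sym (pos-^ 2 h))) (sym (ℤ.pos-* (2 ^ h) (h !)))
  distribute : ∀ f t → f ℤ.* (t ℤ.- 1ℤ) ≡ t ℤ.* f ℤ.- f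
  distribute = solve-∀
  cancel : ∀ f → 1ℤ ℤ.* f ℤ.- f ≡ 0ℤ
  cancel = solve-∀

p≡±1[8]⇒2^[p-1]/2≡1 : ∀ {p} → Prime p → p % 8 ≡ 1 ⊎ p % 8 ≡ 7
  → ∃[ h ] p ≡ suc (2 * h) × ((+ 2) ℤ.^ h ≡ 1ℤ mod p)
p≡±1[8]⇒2^[p-1]/2≡1 {p} p-prime (inj₁ p%8≡1) =
  (t + t) + (t + t) , p≡ , 2^h≡1 (t + t) (t + t) p-prime p≡ (inj₁ refl) (altSign-double t)
  where
  t = p / 8
  arith : ∀ t → 1 + t * 8 ≡ suc (2 * ((t + t) + (t + t)))
  arith = ℕ-Solver.solve-∀
  p≡ : p ≡ suc (2 * ((t + t) + (t + t)))
  p≡ = trans (m≡m%n+[m/n]*n p 8) (trans (cong (_+ t * 8) p%8≡1) (arith t))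
p≡±1[8]⇒2^[p-1]/2≡1 {p} p-prime (inj₂ p%8≡7) =
  suc (t + t) + suc (suc (t + t)) , p≡ ,
  2^h≡1 (suc (t + t)) (suc (suc (t + t))) p-prime p≡ (inj₂ refl) (altSign-double t)
  where
  t = p / 8
  arith : ∀ t → 7 + t * 8 ≡ suc (2 * (suc (t + t) + suc (suc (t + t))))
  arith = ℕ-Solver.solve-∀
  p≡ : p ≡ suc (2 * (suc (t + t) + suc (suc (t + t))))
  p≡ = trans (m≡m%n+[m/n]*n p 8) (trans (cong (_+ t * 8) p%8≡7) (arith t))

-- Alternating harmonic numbers

altHarmonicᵘ : ℕ → ℚᵘ
altHarmonicᵘ zero    = ℚᵘ.0ℚᵘ
altHarmonicᵘ (suc k) = altHarmonicᵘ k ℚᵘ.+ mkℚᵘ (altSign k) k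

toℚᵘ-altHarmonic : ∀ k → ℚ.toℚᵘ (altHarmonic k) ℚᵘ.≃ altHarmonicᵘ k
toℚᵘ-altHarmonic zero    = ℚᵘ.≃-refl
toℚᵘ-altHarmonic (suc k) = ℚᵘ.≃-trans (ℚ.toℚᵘ-homo-+ (altHarmonic k) (altSign k ℚ./ suc k))
  (ℚᵘ.+-cong (toℚᵘ-altHarmonic k) (ℚ.toℚᵘ-fromℚᵘ (mkℚᵘ (altSign k) k)))

toℚᵘ-≃⇒cross : ∀ r q → ℚ.toℚᵘ r ℚᵘ.≃ q → ℚ.↥ r ℤ.* ℚᵘ.↧ q ≡ ℚᵘ.↥ q ℤ.* ℚ.↧ r
toℚᵘ-≃⇒cross (mkℚ _ _ _) q (ℚᵘ.*≡* cross) = cross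

↥-+ : ∀ p q → ℚᵘ.↥ (p ℚᵘ.+ q) ≡ ℚᵘ.↥ p ℤ.* ℚᵘ.↧ q ℤ.+ ℚᵘ.↥ q ℤ.* ℚᵘ.↧ p
↥-+ (mkℚᵘ _ _) (mkℚᵘ _ _) = refl

↧ₙ-+ : ∀ p q → ℚᵘ.↧ₙ (p ℚᵘ.+ q) ≡ ℚᵘ.↧ₙ p * ℚᵘ.↧ₙ q
↧ₙ-+ (mkℚᵘ _ _) (mkℚᵘ _ _) = refl

↧ₙ-altHarmonicᵘ : ∀ k → ℚᵘ.↧ₙ (altHarmonicᵘ k) ≡ k !
↧ₙ-altHarmonicᵘ zero    = refl
↧ₙ-altHarmonicᵘ (suc k) = begin
  ℚᵘ.↧ₙ (altHarmonicᵘ k ℚᵘ.+ mkℚᵘ (altSign k) k)  ≡⟨ ↧ₙ-+ (altHarmonicᵘ k) (mkℚᵘ (altSign k) k) ⟩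
  ℚᵘ.↧ₙ (altHarmonicᵘ k) * suc k                  ≡⟨ cong (_* suc k) (↧ₙ-altHarmonicᵘ k) ⟩
  k ! * suc k                                     ≡⟨ *-comm (k !) (suc k) ⟩
  suc k !                                         ∎
  where open ≡-Reasoning

altHarmonicNumerator : ℕ → ℤ
altHarmonicNumerator k = ℚᵘ.↥ (altHarmonicᵘ k)

altHarmonicNumerator-suc : ∀ k → altHarmonicNumerator (suc k)
  ≡ altHarmonicNumerator k ℤ.* + suc k ℤ.+ altSign k ℤ.* + (k !)
altHarmonicNumerator-suc k =
  trans (↥-+ (altHarmonicᵘ k) (mkℚᵘ (altSign k) k))
        (cong (λ n → altHarmonicNumerator k ℤ.* + suc k ℤ.+ altSign k ℤ.* + n) (↧ₙ-altHarmonicᵘ k))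

altHarmonic-≡0 : ∀ {p} d → Prime p → d < p → altHarmonicNumerator d ≡ 0ℤ mod p
  → ≡0modp p (altHarmonic d)
altHarmonic-≡0 {p} d p-prime d<p A≡0 = cancel-mod p-prime (prime∤! d p-prime d<p) (begin
  + (d !) ℤ.* ℚ.↥ H                  ≡⟨ ℤ.*-comm (+ (d !)) (ℚ.↥ H) ⟩
  ℚ.↥ H ℤ.* + (d !)                  ≡⟨ cong (λ n → ℚ.↥ H ℤ.* + n) (↧ₙ-altHarmonicᵘ d) ⟨
  ℚ.↥ H ℤ.* ℚᵘ.↧ (altHarmonicᵘ d)    ≡⟨ toℚᵘ-≃⇒cross H (altHarmonicᵘ d) (toℚᵘ-altHarmonic d) ⟩
  altHarmonicNumerator d ℤ.* ℚ.↧ H   ≈⟨ *-cong-mod A≡0 (≡⇒≡-mod refl) ⟩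
  0ℤ                                 ∎)
  where
  open ≡-mod-Reasoning p
  H = altHarmonic d

C-≡-altSign : ∀ {p n} → Prime p → p ∣ suc n → ∀ k → k < p → + (n C k) ≡ altSign k mod p
C-≡-altSign _ _ zero _ = ≡⇒≡-mod refl
C-≡-altSign {p} {n} p-prime p∣n+1 (suc k) k+1<p = begin
  + (n C suc k)                    ≡⟨ pos-m+n≡o⇒n≡o-m (n C k) (n C suc k) (nCk+nC[k+1]≡[n+1]C[k+1] n k) ⟩
  + (suc n C suc k) ℤ.- + (n C k)  ≈⟨ +-cong-mod p∣C[n+1,k+1] (-‿cong-mod (C-≡-altSign p-prime p∣n+1 k (<⇒≤ k+1<p))) ⟩
  0ℤ ℤ.- altSign k                 ≡⟨ ℤ.+-identityˡ _ ⟩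
  ℤ.- altSign k                    ≡⟨ altSign-suc k ⟨
  altSign (suc k)                  ∎
  where
  open ≡-mod-Reasoning p
  p∣C[n+1,k+1] : + (suc n C suc k) ≡ 0ℤ mod p
  p∣C[n+1,k+1] = ∣⇒≡0-mod (+ (suc n C suc k)) (prime∣C p-prime p∣n+1 (s≤s z≤n) k+1<p)

-- With N = suc n: (k + 1) C(N, k + 1) = N C(N − 1, k), and N C(N − 1, k) ≡ N (−1)ᵏ (mod p²)
-- because p ∣ N and C(N − 1, k) ≡ (−1)ᵏ (mod p).
∑-C-≡-altHarmonic : ∀ {p n} → Prime p → p ∣ suc n → ∀ k → k < p →
  + (k ! * ∑ (suc k) (suc n C_)) ≡ + (k !) ℤ.+ + suc n ℤ.* altHarmonicNumerator k mod (p * p)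
∑-C-≡-altHarmonic {n = n} _ _ zero _ = ≡⇒≡-mod (sym (cong (ℤ._+_ 1ℤ) (ℤ.*-zeroʳ (+ suc n))))
∑-C-≡-altHarmonic {p} {n} p-prime p∣n+1 (suc k) k+1<p = begin
  + (suc k ! * (S + suc n C suc k))
    ≡⟨ cong +_ (trans (distribute (suc k) (k !) S _) (cong (λ c → suc k * (k ! * S) + k ! * c) (C-absorb n k))) ⟩
  + (suc k * (k ! * S) + k ! * (suc n * (n C k)))
    ≡⟨ trans (ℤ.pos-+ (suc k * (k ! * S)) (k ! * (suc n * (n C k))))
             (cong₂ ℤ._+_ (ℤ.pos-* (suc k) (k ! * S))
                          (trans (ℤ.pos-* (k !) (suc n * (n C k))) (cong (+ (k !) ℤ.*_) (ℤ.pos-* (suc n) (n C k))))) ⟩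
  + suc k ℤ.* + (k ! * S) ℤ.+ + (k !) ℤ.* (+ suc n ℤ.* + (n C k))
    ≈⟨ +-cong-mod (*-congˡ-mod (+ suc k) (∑-C-≡-altHarmonic p-prime p∣n+1 k k<p))
                  (*-congˡ-mod (+ (k !)) (scale-mod p∣n+1 (C-≡-altSign p-prime p∣n+1 k k<p))) ⟩
  + suc k ℤ.* (+ (k !) ℤ.+ + suc n ℤ.* A k) ℤ.+ + (k !) ℤ.* (+ suc n ℤ.* altSign k)
    ≡⟨ regroup (+ suc k) (+ (k !)) (+ suc n) (A k) (altSign k) ⟩
  + suc k ℤ.* + (k !) ℤ.+ + suc n ℤ.* (A k ℤ.* + suc k ℤ.+ altSign k ℤ.* + (k !))
    ≡⟨ cong₂ ℤ._+_ (ℤ.pos-* (suc k) (k !)) (cong (+ suc n ℤ.*_) (altHarmonicNumerator-suc k)) ⟨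
  + (suc k !) ℤ.+ + suc n ℤ.* A (suc k)
    ∎
  where
  open ≡-mod-Reasoning (p * p)
  A = altHarmonicNumerator
  S = ∑ (suc k) (suc n C_)
  k<p = <⇒≤ k+1<p
  distribute : ∀ a f s c → a * f * (s + c) ≡ a * (f * s) + f * (a * c)
  distribute = ℕ-Solver.solve-∀
  regroup : ∀ a f n A s → a ℤ.* (f ℤ.+ n ℤ.* A) ℤ.+ f ℤ.* (n ℤ.* s)
                        ≡ a ℤ.* f ℤ.+ n ℤ.* (A ℤ.* a ℤ.+ s ℤ.* f)
  regroup = solve-∀

-- The polynomial f

if-≡ᵇ-true : ∀ {i e} (a : ℕ) → i ≡ e → (if i ≡ᵇ e then a else 0) ≡ a
if-≡ᵇ-true {i} {e} a i≡e = cong (if_then a else 0) (dec-true (i ≟ e) i≡e)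

if-≡ᵇ-false : ∀ {i e} (a : ℕ) → i ≢ e → (if i ≡ᵇ e then a else 0) ≡ 0
if-≡ᵇ-false {i} {e} a i≢e = cong (if_then a else 0) (dec-false (i ≟ e) i≢e)

fCoeff-∑ : ∀ m n e → fCoeff m n e ≡ ∑ (suc n) (λ j → if j C m ≡ᵇ e then n C j else 0)
fCoeff-∑ m n e = Sum.fromList (suc n) (λ j → if j C m ≡ᵇ e then n C j else 0)

fDeg-≡ : ∀ m n → fDeg m n ≡ n C m
fDeg-≡ m n = trans (Maximum.fromList (suc n) (_C m)) (⨆-monotone n (C-monoˡ-≤ m))

fCoeff-leading : ∀ {m n} → 0 < m → m ≤ n → fCoeff m n (n C m) ≡ 1
fCoeff-leading {m} {n} 0<m m≤n = begin
  fCoeff m n (n C m)  ≡⟨ fCoeff-∑ m n (n C m) ⟩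
  ∑ n term + term n   ≡⟨ cong₂ _+_ (∑-zero n below) (if-≡ᵇ-true {n C m} (n C n) refl) ⟩
  n C n               ≡⟨ nCn≡1 n ⟩
  1                   ∎
  where
  open ≡-Reasoning
  term : ℕ → ℕ
  term j = if j C m ≡ᵇ n C m then n C j else 0
  below : ∀ j → j < n → term j ≡ 0
  below j j<n = if-≡ᵇ-false (n C j) (<⇒≢ (C-monoˡ-< 0<m m≤n j<n))

fCoeff-∣ : ∀ {p m n e} → (∀ j → m ≤ j → j < n → p ∣ n C j) → 0 < e → e < n C m → p ∣ fCoeff m n e
fCoeff-∣ {p} {m} {n} {e} p∣C 0<e e<nCm = subst (p ∣_) (sym (fCoeff-∑ m n e)) (∑-∣ (suc n) p∣term)
  where
  p∣term : ∀ j → j < suc n → p ∣ (if j C m ≡ᵇ e then n C j else 0)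
  p∣term j j<1+n with j C m ≟ e
  ... | no  jCm≢e = subst (p ∣_) (sym (if-≡ᵇ-false (n C j) jCm≢e)) (p ∣0)
  ... | yes jCm≡e = subst (p ∣_) (sym (if-≡ᵇ-true (n C j) jCm≡e)) (p∣C j m≤j j<n)
    where
    m≤j : m ≤ j
    m≤j = ≮⇒≥ (λ j<m → <⇒≢ 0<e (trans (sym (k>n⇒nCk≡0 j<m)) jCm≡e))
    j<n : j < n
    j<n = ≤∧≢⇒< (s≤s⁻¹ j<1+n) (λ j≡n → <⇒≢ e<nCm (trans (sym jCm≡e) (cong (_C m) j≡n)))

fCoeff-constant : ∀ {m n} → 0 < m → m ≤ suc n → fCoeff m n 0 ≡ ∑ m (n C_)
fCoeff-constant {m} {n} 0<m m≤1+n = begin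
  fCoeff m n 0                                   ≡⟨ fCoeff-∑ m n 0 ⟩
  ∑ (suc n) term                                 ≡⟨ cong (λ k → ∑ k term) (m+[n∸m]≡n m≤1+n) ⟨
  ∑ (m + (suc n ∸ m)) term                       ≡⟨ Sum.split m (suc n ∸ m) term ⟩
  ∑ m term + ∑ (suc n ∸ m) (λ i → term (m + i))  ≡⟨ cong₂ _+_ (Sum.pointwise m below) (∑-zero _ above) ⟩
  ∑ m (n C_) + 0                                 ≡⟨ +-identityʳ (∑ m (n C_)) ⟩
  ∑ m (n C_)                                     ∎
  where
  open ≡-Reasoning
  term : ℕ → ℕ
  term j = if j C m ≡ᵇ 0 then n C j else 0
  below : ∀ j → j < m → term j ≡ n C j
  below j j<m = if-≡ᵇ-true (n C j) (k>n⇒nCk≡0 j<m)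
  above : ∀ i → i < suc n ∸ m → term (m + i) ≡ 0
  above i _ = if-≡ᵇ-false (n C (m + i)) (>⇒≢ (C-pos (m≤m+n m i)))

f-isEisenstein : ∀ {p d n} → Prime p → d < p → p ∣ n → d < n
  → p ∣ fCoeff (n ∸ d) n 0 → ¬ p ^ 2 ∣ fCoeff (n ∸ d) n 0 → IsEisenstein p (f (n ∸ d) n)
f-isEisenstein {p} {d} {n} p-prime d<p p∣n d<n p∣c₀ p²∤c₀ = leading , lower , p²∤c₀
  where
  m = n ∸ d
  0<m : 0 < m
  0<m = m<n⇒0<n∸m d<n
  leading : ¬ p ∣ fCoeff m n (fDeg m n)
  leading p∣lead = >⇒∤ (prime>1 p-prime)
    (subst (p ∣_) (trans (cong (fCoeff m n) (fDeg-≡ m n)) (fCoeff-leading 0<m (m∸n≤m n d))) p∣lead)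
  p∣C : ∀ j → m ≤ j → j < n → p ∣ n C j
  p∣C j m≤j j<n = subst (p ∣_) (sym (nCk≡nC[n∸k] (<⇒≤ j<n))) (prime∣C p-prime p∣n (m<n⇒0<n∸m j<n) n∸j<p)
    where
    n∸j<p : n ∸ j < p
    n∸j<p = ≤-<-trans (∸-monoʳ-≤ n m≤j) (subst (_< p) (sym (m∸[m∸n]≡n (<⇒≤ d<n))) d<p)
  lower : ∀ i → i < fDeg m n → p ∣ fCoeff m n i
  lower zero    _     = p∣c₀
  lower (suc i) i<deg = fCoeff-∣ p∣C (s≤s z≤n) (subst (suc i <_) (fDeg-≡ m n) i<deg)

constantTerm-≡ : ∀ {p n d} → Prime p → p ∣ suc n → d < p → + (2 ^ suc n) ≡ 1ℤ mod (p * p)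
  → + (d !) ℤ.* + fCoeff (suc n ∸ d) (suc n) 0 ≡ ℤ.- (+ suc n ℤ.* altHarmonicNumerator d) mod (p * p)
constantTerm-≡ {p} {n} {d} p-prime p∣n+1 d<p 2ⁿ≡1 = begin
  + (d !) ℤ.* + c₀
    ≡⟨ cong (+ (d !) ℤ.*_) (pos-m+n≡o⇒n≡o-m S c₀ S+c₀≡2ⁿ) ⟩
  + (d !) ℤ.* (+ (2 ^ suc n) ℤ.- + S)
    ≡⟨ trans (cong (λ z → + (d !) ℤ.* + (2 ^ suc n) ℤ.- z) (ℤ.pos-* (d !) S)) (distribute (+ (d !)) _ (+ S)) ⟨
  + (d !) ℤ.* + (2 ^ suc n) ℤ.- + (d ! * S)
    ≈⟨ +-cong-mod (*-congˡ-mod (+ (d !)) 2ⁿ≡1) (-‿cong-mod (∑-C-≡-altHarmonic p-prime p∣n+1 d d<p)) ⟩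
  + (d !) ℤ.* 1ℤ ℤ.- (+ (d !) ℤ.+ + suc n ℤ.* A)
    ≡⟨ cancel (+ (d !)) (+ suc n ℤ.* A) ⟩
  ℤ.- (+ suc n ℤ.* A)
    ∎
  where
  open ≡-mod-Reasoning (p * p)
  A = altHarmonicNumerator d
  m = suc n ∸ d
  c₀ = fCoeff m (suc n) 0
  S = ∑ (suc d) (suc n C_)
  d<n+1 : d < suc n
  d<n+1 = <-≤-trans d<p (∣⇒≤ p∣n+1)
  c₀≡∑ : c₀ ≡ ∑ m (suc n C_)
  c₀≡∑ = fCoeff-constant (m<n⇒0<n∸m d<n+1) (≤-trans (m∸n≤m (suc n) d) (n≤1+n _))
  S+c₀≡2ⁿ : S + c₀ ≡ 2 ^ suc n
  S+c₀≡2ⁿ = trans (+-comm S c₀) (trans (cong (_+ S) c₀≡∑) (∑-C-complement m d (m∸n+n≡m (<⇒≤ d<n+1))))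
  distribute : ∀ a b c → a ℤ.* b ℤ.- a ℤ.* c ≡ a ℤ.* (b ℤ.- c)
  distribute = solve-∀
  cancel : ∀ f x → f ℤ.* 1ℤ ℤ.- (f ℤ.+ x) ≡ ℤ.- x
  cancel = solve-∀

f[Np∸d,Np]-isEisenstein : ∀ {p d N} → Prime p → d < p → ¬ ≡0modp p (altHarmonic d) → ¬ p ∣ N
  → (+ 2) ℤ.^ N ≡ 1ℤ mod p → IsEisenstein p (f (N * p ∸ d) (N * p))
f[Np∸d,Np]-isEisenstein {p} {d} {zero} _ _ _ p∤0 _ = contradiction (p ∣0) p∤0
f[Np∸d,Np]-isEisenstein {p@(suc q)} {d} {N@(suc _)} p-prime d<p H≢0 p∤N 2ᴺ≡1 =
  f-isEisenstein p-prime d<p p∣n (<-≤-trans d<p (∣⇒≤ p∣n)) p∣c₀ p²∤c₀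
  where
  n = N * p
  p∣n : p ∣ n
  p∣n = n∣m*n N
  A = altHarmonicNumerator d
  c₀ = fCoeff (n ∸ d) n 0
  2ⁿ≡1 : + (2 ^ n) ≡ 1ℤ mod (p * p)
  2ⁿ≡1 = subst (λ z → z ≡ 1ℤ mod (p * p)) (trans (ℤ.^-*-assoc (+ 2) N p) (sym (pos-^ 2 n)))
               (^-≡1-mod-square 2ᴺ≡1)
  d!c₀≡-nA : + (d !) ℤ.* + c₀ ≡ ℤ.- (+ n ℤ.* A) mod (p * p)
  d!c₀≡-nA = constantTerm-≡ p-prime p∣n d<p 2ⁿ≡1
  p∣c₀ : p ∣ c₀
  p∣c₀ = cancel-mod p-prime (prime∤! d p-prime d<p) (begin
    + (d !) ℤ.* + c₀  ≈⟨ mod-weaken p d!c₀≡-nA ⟩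
    ℤ.- (+ n ℤ.* A)   ≈⟨ -‿cong-mod (*-cong-mod (∣⇒≡0-mod (+ n) p∣n) (≡⇒≡-mod refl)) ⟩
    0ℤ                ∎)
    where open ≡-mod-Reasoning p
  p²∤c₀ : ¬ p ^ 2 ∣ c₀
  p²∤c₀ p²∣c₀ = H≢0 (altHarmonic-≡0 d p-prime d<p (∣⇒≡0-mod A (cancel-mod p-prime p∤N (mod-divide {c = N} (begin
    + n ℤ.* A               ≡⟨ ℤ.neg-involutive (+ n ℤ.* A) ⟨
    ℤ.- ℤ.- (+ n ℤ.* A)     ≈⟨ -‿cong-mod (mod-sym d!c₀≡-nA) ⟩
    ℤ.- (+ (d !) ℤ.* + c₀)  ≈⟨ -‿cong-mod (*-congˡ-mod (+ (d !)) c₀≡0) ⟩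
    ℤ.- (+ (d !) ℤ.* 0ℤ)    ≡⟨ cong ℤ.-_ (ℤ.*-zeroʳ (+ (d !))) ⟩
    0ℤ                      ∎)))))
    where
    open ≡-mod-Reasoning (p * p)
    c₀≡0 : + c₀ ≡ 0ℤ mod (p * p)
    c₀≡0 = ∣⇒≡0-mod (+ c₀) (subst (_∣ c₀) (cong (p *_) (*-identityʳ p)) p²∣c₀)

proposition6p1 : (p d : ℕ) → Prime p → p ≢ 2 → 1 ≤ d → d ≤ p ∸ 1
    → ¬ ≡0modp p (altHarmonic d)
    → ((j : ℕ) → 1 ≤ j → ¬ (p ∣ j)
    → IsEisenstein p (f ((j * (p ∸ 1) * p) ∸ d) (j * (p ∸ 1) * p)))
    × ((p % 8 ≡ 1 ⊎ p % 8 ≡ 7) → (j : ℕ) → 1 ≤ j → ¬ (p ∣ j)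
    → IsEisenstein p (f ((j * (p ∸ 1) * p / 2) ∸ d) (j * (p ∸ 1) * p / 2)))
proposition6p1 zero _ p-prime = contradiction p-prime ¬prime[0]
proposition6p1 p@(suc q) d p-prime p≢2 _ d≤q H≢0 = part₁ , part₂
  where
  d<p : d < p
  d<p = s≤s d≤q
  q>0 : 0 < q
  q>0 = s≤s⁻¹ (prime>1 p-prime)
  part₁ : (j : ℕ) → 1 ≤ j → ¬ p ∣ j → IsEisenstein p (f (j * q * p ∸ d) (j * q * p))
  part₁ j _ p∤j = f[Np∸d,Np]-isEisenstein p-prime d<p H≢0 (prime∤m*n p-prime p∤j q>0 ≤-refl)
    (^-≡1-mod-multiple j q (fermat-2 p-prime p≢2))
  part₂ : p % 8 ≡ 1 ⊎ p % 8 ≡ 7 → (j : ℕ) → 1 ≤ j → ¬ p ∣ j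
    → IsEisenstein p (f (j * q * p / 2 ∸ d) (j * q * p / 2))
  part₂ p≡±1 j _ p∤j with p≡±1[8]⇒2^[p-1]/2≡1 p-prime p≡±1
  ... | h , refl , 2ʰ≡1 = subst (λ n → IsEisenstein p (f (n ∸ d) n)) (sym halve)
    (f[Np∸d,Np]-isEisenstein p-prime d<p H≢0 (prime∤m*n p-prime p∤j (*-cancelˡ-< 2 0 h q>0) (s≤s (m≤m+n h (h + 0))))
      (^-≡1-mod-multiple j h 2ʰ≡1))
    where
    regroup : ∀ j h p → j * (2 * h) * p ≡ j * h * p * 2
    regroup = ℕ-Solver.solve-∀
    halve : j * (2 * h) * p / 2 ≡ j * h * p
    halve = trans (cong (_/ 2) (regroup j h p)) (m*n/n≡m (j * h * p) 2)
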